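{- Let $r\ge 2$ and let $\alpha=(\alpha_i)_{i\ge 1}$ be any infinite sequence with entries in $[r]$. Then the sequence $(k_i)_{i\ge 0}$ and each of the sequences $x_s=(x_{s,0},x_{s,1},\dots)$, $s\in[r]$, defined in the context are strictly increasing.
   Context: $[r]=\{1,\dots,r\}$. For $i\ge 0$ and $s\in[r]$ let $\nu_{i,s}:=1+|\{1\le j\le i:\alpha_j=s\}|$. Define integers recursively: $x_{s,0}:=0$ for all $s\in[r]$, and for $i=0,1,2,\dots$ in turn let $k_i:=1+\sum_{s\in[r]}\min_{j_1,j_2\ge0,\ j_1+j_2=\nu_{i,s}-1}(x_{s,j_1}+x_{s,j_2})$ and then set $x_{s,\nu_{i,s}}:=k_i$ for $s=\alpha_{i+1}$ (all values used are defined at that time). For each $s$, $x_s$ is the resulting sequence $(x_{s,0},x_{s,1},\dots)$ (finite if $s$ occurs only finitely often in $\alpha$). -}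

module Defs where

open import Data.Nat using (ℕ; zero; suc; _+_; _⊓_)
open import Data.Fin using (Fin; _≟_)
open import Data.List using (List; []; _∷_; [_]; _++_; zipWith; reverse; foldr; map; allFin)
open import Data.Nat.ListAction using (sum)
open import Relation.Nullary using (yes; no)

-- minimum of a (non-empty) list of naturals; the empty case never occurs below
minL : List ℕ → ℕ
minL []       = 0
minL (x ∷ xs) = foldr _⊓_ x xs

-- For L = (x_0,…,x_{n-1}) (length n = ν), the quantity
--   min_{j1+j2 = n-1} (x_{j1} + x_{j2})
-- computed as the minimum of the list (x_j + x_{n-1-j})_{j<n}.
minPair : List ℕ → ℕ
minPair L = minL (zipWith _+_ L (reverse L))

module Process (r : ℕ) (α : ℕ → Fin r) where
  -- Convention: α i  stands for the paper's  α_{i+1}  (i ≥ 0).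

  -- State before step i: for each s, the list (x_{s,0}, …, x_{s,ν_{i,s}-1}).
  -- k_i computed from a state:
  kOf : (Fin r → List ℕ) → ℕ
  kOf st = suc (sum (map (λ s → minPair (st s)) (allFin r)))

  state : ℕ → Fin r → List ℕ
  state zero    s = [ 0 ]
  state (suc i) s with α i ≟ s
  ... | yes _ = state i s ++ [ kOf (state i) ]
  ... | no  _ = state i s

  k : ℕ → ℕ
  k i = kOf (state i)

module Submission where

-- Write ν_s for the current length of column x_s and
--   m_s = min_{j1+j2 = ν_s - 1} (x_{s,j1} + x_{s,j2}),   so that   k_i = 1 + Σ_s m_s.
-- We show by induction on i the invariant
--   (Inv)  for every s, the column x_s followed by k_i is strictly increasing.
-- If x_0 < … < x_{n-1} < b, the pair sums of (x_0,…,x_{n-1},b) are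
--   x_j + x_{n-j}  (j < n, reading x_n := b)   and   b + x_0,
-- and each of them strictly exceeds a pair sum of the old column
-- (x_j + x_{n-1-j} resp. x_{n-1} + x_0).  Hence m_{α_{i+1}} strictly increases,
-- the other m_s are unchanged, and k_{i+1} > k_i; this in turn shows that
-- (Inv) survives the step.

open import Defs
open import Level using (Level)
open import Function using (flip)
open import Data.Nat using (ℕ; suc; _≤_; _<_; _>_; _+_; z≤n; s≤s)
open import Data.Nat.Properties
  using (≤-refl; ≤-trans; <-trans; <⇒≤; ≤-<-trans; m⊓n≤m; m⊓n≤n; ⊓-glb; m≤m+n;
         +-monoʳ-<; +-monoˡ-<; +-mono-≤; +-mono-<-≤; +-mono-≤-<; suc-injective)
open import Data.Fin using (Fin; _≟_)
open import Data.Product using (_×_; _,_)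
open import Data.List using (List; []; _∷_; [_]; _++_; zipWith; reverse; reverseAcc; map; allFin; length)
open import Data.List.Properties using (reverse-++; length-reverse)
open import Data.Nat.ListAction using (sum)
open import Data.List.Relation.Unary.Linked using (Linked; []; [-]; _∷_)
open import Data.List.Relation.Unary.All as All using (All; []; _∷_)
open import Data.List.Relation.Unary.Any using (here; there)
open import Data.List.Membership.Propositional using (_∈_)
open import Data.List.Membership.Propositional.Properties using (∈-allFin)
open import Data.Empty using (⊥-elim)
open import Relation.Nullary using (yes; no)
open import Relation.Binary using (Rel; Transitive)
open import Relation.Binary.PropositionalEquality using (_≡_; refl; sym; subst)

private
  variable
    a ℓ : Level
    A : Set a

module _ {R : Rel A ℓ} where

  linked-prefix : ∀ {xs ys} → Linked R (xs ++ ys) → Linked R xs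
  linked-prefix {xs = []}         _       = []
  linked-prefix {xs = x ∷ []}     _       = [-]
  linked-prefix {xs = x ∷ y ∷ xs} (r ∷ l) = r ∷ linked-prefix l

  linked-snoc : ∀ {xs c b} → Linked R (xs ++ [ c ]) → R c b → Linked R ((xs ++ [ c ]) ++ [ b ])
  linked-snoc {xs = []}         _       cb = cb ∷ [-]
  linked-snoc {xs = x ∷ []}     (r ∷ _) cb = r ∷ cb ∷ [-]
  linked-snoc {xs = x ∷ y ∷ xs} (r ∷ l) cb = r ∷ linked-snoc {xs = y ∷ xs} l cb

  linked-reverse : ∀ {xs} → Linked R xs → Linked (flip R) (reverse xs)
  linked-reverse []      = []
  linked-reverse [-]     = [-]
  linked-reverse (r ∷ l) = onto-acc l (r ∷ [-])
    where
    onto-acc : ∀ {x xs acc} → Linked R (x ∷ xs) → Linked (flip R) (x ∷ acc) →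
               Linked (flip R) (reverseAcc (x ∷ acc) xs)
    onto-acc [-]     done = done
    onto-acc (r ∷ l) done = onto-acc l (r ∷ done)

  module _ (trans : Transitive R) where

    linked-below-last : ∀ {xs b} → Linked R (xs ++ [ b ]) → All (λ x → R x b) xs
    linked-below-last {xs = []}         _       = []
    linked-below-last {xs = x ∷ []}     (r ∷ _) = r ∷ []
    linked-below-last {xs = x ∷ y ∷ xs} (r ∷ l) with linked-below-last {xs = y ∷ xs} l
    ... | ryb ∷ rest = trans r ryb ∷ ryb ∷ rest

    linked-raise-last : ∀ {xs c b} → Linked R (xs ++ [ c ]) → R c b → Linked R (xs ++ [ b ])
    linked-raise-last {xs = []}         _       _  = [-]
    linked-raise-last {xs = x ∷ []}     (r ∷ _) cb = trans r cb ∷ [-]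
    linked-raise-last {xs = x ∷ y ∷ xs} (r ∷ l) cb = r ∷ linked-raise-last {xs = y ∷ xs} l cb

minL-lower : ∀ x xs → All (minL (x ∷ xs) ≤_) (x ∷ xs)
minL-lower x []       = ≤-refl ∷ []
minL-lower x (y ∷ ys) with minL-lower x ys
... | m≤x ∷ m≤ys = ≤-trans (m⊓n≤n y _) m≤x ∷ m⊓n≤m y _ ∷ All.map (≤-trans (m⊓n≤n y _)) m≤ys

minL-above : ∀ {c} x xs → All (c <_) (x ∷ xs) → c < minL (x ∷ xs)
minL-above x []       (c<x ∷ [])        = c<x
minL-above x (y ∷ ys) (c<x ∷ c<y ∷ c<ys) = ⊓-glb c<y (minL-above x ys (c<x ∷ c<ys))

sum-mono-≤ : ∀ {f g : A → ℕ} → (∀ x → f x ≤ g x) → ∀ xs → sum (map f xs) ≤ sum (map g xs)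
sum-mono-≤ f≤g []       = ≤-refl
sum-mono-≤ f≤g (x ∷ xs) = +-mono-≤ (f≤g x) (sum-mono-≤ f≤g xs)

sum-mono-< : ∀ {f g : A → ℕ} → (∀ x → f x ≤ g x) → ∀ {y xs} → y ∈ xs → f y < g y →
             sum (map f xs) < sum (map g xs)
sum-mono-< f≤g {xs = x ∷ xs} (here refl) fy<gy = +-mono-<-≤ fy<gy (sum-mono-≤ f≤g xs)
sum-mono-< f≤g {xs = x ∷ xs} (there y∈xs) fy<gy = +-mono-≤-< (f≤g x) (sum-mono-< f≤g y∈xs fy<gy)

-- Then each sum of (u ∷ us) ++ [b] with (a ∷ D) strictly
-- exceeds a sum of (u ∷ us) with D: the j-th one since a_j > d_j, the last one
-- since b is larger than the last u.
snoc-sums-exceed : ∀ {c a b} u us D → suc (length us) ≡ length D →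
  All (_< b) (u ∷ us) → Linked _>_ (a ∷ D) → All (c ≤_) (zipWith _+_ (u ∷ us) D) →
  All (c <_) (zipWith _+_ ((u ∷ us) ++ [ b ]) (a ∷ D))
snoc-sums-exceed u []        (d ∷ []) _ (u<b ∷ []) (a>d ∷ _) (c≤u+d ∷ []) =
  ≤-<-trans c≤u+d (+-monoʳ-< u a>d) ∷ ≤-<-trans c≤u+d (+-monoˡ-< d u<b) ∷ []
snoc-sums-exceed u (u′ ∷ us) (d ∷ D) len (_ ∷ us<b) (a>d ∷ D↘) (c≤u+d ∷ c≤sums) =
  ≤-<-trans c≤u+d (+-monoʳ-< u a>d) ∷ snoc-sums-exceed u′ us D (suc-injective len) us<b D↘ c≤sums
snoc-sums-exceed u []       []              () _ _ _
snoc-sums-exceed u []       (_ ∷ _ ∷ _)     () _ _ _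
snoc-sums-exceed u (_ ∷ _)  []              () _ _ _

minL-sums-grow : ∀ {b} u us D → suc (length us) ≡ length D →
  All (_< b) (u ∷ us) → Linked _>_ (b ∷ D) →
  minL (zipWith _+_ (u ∷ us) D) < minL (zipWith _+_ ((u ∷ us) ++ [ b ]) (b ∷ D))
minL-sums-grow u us (d ∷ D) len us<b b↘D =
  minL-above _ _ (snoc-sums-exceed u us (d ∷ D) len us<b b↘D (minL-lower _ _))

minPair-snoc : ∀ xs b → 0 < b → Linked _<_ (xs ++ [ b ]) → minPair xs < minPair (xs ++ [ b ])
minPair-snoc []       b 0<b _    = ≤-trans 0<b (m≤m+n b b)
minPair-snoc (u ∷ us) b _   xs↗b rewrite reverse-++ (u ∷ us) [ b ] =
  minL-sums-grow u us (reverse (u ∷ us)) (sym (length-reverse (u ∷ us)))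
    (linked-below-last <-trans xs↗b)
    (subst (Linked _>_) (reverse-++ (u ∷ us) [ b ]) (linked-reverse xs↗b))

module _ (r : ℕ) (α : ℕ → Fin r) where
  open Process r α

  state-hit : ∀ i → state (suc i) (α i) ≡ state i (α i) ++ [ k i ]
  state-hit i with α i ≟ α i
  ... | yes _   = refl
  ... | no miss = ⊥-elim (miss refl)

  Inv : ℕ → Set
  Inv i = ∀ s → Linked _<_ (state i s ++ [ k i ])

  minPair-mono : ∀ i → Inv i → ∀ s → minPair (state i s) ≤ minPair (state (suc i) s)
  minPair-mono i I s with α i ≟ s
  ... | yes _ = <⇒≤ (minPair-snoc (state i s) (k i) (s≤s z≤n) (I s))
  ... | no _  = ≤-refl

  k-step : ∀ i → Inv i → k i < k (suc i)
  k-step i I = s≤s (sum-mono-< (minPair-mono i I) (∈-allFin (α i)) hit-grows)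
    where
    hit-grows : minPair (state i (α i)) < minPair (state (suc i) (α i))
    hit-grows = subst (λ col → minPair (state i (α i)) < minPair col) (sym (state-hit i))
                      (minPair-snoc (state i (α i)) (k i) (s≤s z≤n) (I (α i)))

  -- The invariant holds initially (columns (0), k_0 = 1) and is preserved:
  -- the extended column ends in k_i < k_{i+1}, the others end below k_i < k_{i+1}.
  inv : ∀ i → Inv i
  inv 0       s = s≤s z≤n ∷ [-]
  inv (suc i) s with α i ≟ s
  ... | yes _ = linked-snoc (inv i s) (k-step i (inv i))
  ... | no _  = linked-raise-last <-trans (inv i s) (k-step i (inv i))

-- Lemma 11: k is strictly increasing, and so is every column x_s, being a
-- prefix of a list linked by the invariant.
lemma11 : (r : ℕ) → 2 ≤ r → (α : ℕ → Fin r) →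
    ((i : ℕ) → Process.k r α i < Process.k r α (suc i))
    × ((s : Fin r) (i : ℕ) → Linked _<_ (Process.state r α i s))
lemma11 r _ α =
    (λ i → k-step r α i (inv r α i))
  , (λ s i → linked-prefix (inv r α i s))
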